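{- $\mathsf{DLBWE}$ is $\mathcal H_\beta(@)$-definable if and only if (B8) is relatively $\mathcal H_\beta(@)$-definable with respect to $\mathsf{LBWE}$.
   Context: A 3-frame is $\langle W,B\rangle$, $B\subseteq W^3$; $\#(x,y,z)$ means pairwise distinct. $\mathsf{LBWE}$: 3-frames satisfying (B1) $B(x,y,z)\to\#(x,y,z)$; (B2) $B(x,y,z)\to B(z,y,x)$; (B3) $B(x,y,z)\to\neg B(x,z,y)$; (B4) $B(x,y,z)\wedge B(y,z,u)\to B(x,y,u)$; (B5) $B(x,y,z)\wedge B(y,u,z)\to B(x,y,u)$; (B6) $\#(x,y,z)\to B(x,y,z)\vee B(x,z,y)\vee B(y,x,z)$; (B7) $\forall y\exists x\exists z\,B(x,y,z)$. $\mathsf{DLBWE}$: members of $\mathsf{LBWE}$ satisfying (B8) $x\neq z\to\exists y\,B(x,y,z)$. $\mathcal H_\beta(@)$: $\varphi::=\top\mid p\mid i\mid\neg\varphi\mid\varphi\wedge\psi\mid\langle B\rangle(\varphi,\psi)\mid @_i\varphi$; valuations map variables to subsets, nominals to singletons; $w\Vdash\langle B\rangle(\varphi,\psi)$ iff there are $x,y$ with $x\Vdash\varphi$, $y\Vdash\psi$, $B(x,w,y)$; $w\Vdash i$ iff $V(i)=\{w\}$; $w\Vdash @_i\varphi$ iff the element of $V(i)$ satisfies $\varphi$. A class $K$ is $\mathcal H_\beta(@)$-definable if some set $\Phi$ of formulas satisfies: for every 3-frame $\mathfrak F$, $\mathfrak F\in K$ iff all of $\Phi$ is valid on $\mathfrak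 F$. (B8) is relatively definable w.r.t. $\mathsf{LBWE}$ if some set $\Phi$ satisfies: for every $\mathfrak F\in\mathsf{LBWE}$, $\mathfrak F$ satisfies (B8) iff all of $\Phi$ is valid on $\mathfrak F$. -}

module Defs where

open import Data.Nat using (ℕ)
import Level
open import Data.Unit using (⊤)
open import Data.Product using (Σ; ∃; ∃-syntax; _×_)
open import Data.Sum using (_⊎_)
open import Relation.Nullary using (¬_)
open import Relation.Binary.PropositionalEquality using (_≡_)
open import Relation.Unary using (Pred; _∈_)
open import Function.Bundles using (_⇔_)

record Frame : Set₁ where
  field
    W : Set
    B : W → W → W → Set

#[_,_,_] : {W : Set} → W → W → W → Set
#[ x , y , z ] = ¬ x ≡ y × ¬ x ≡ z × ¬ y ≡ z

module _ (F : Frame) where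
  open Frame F
  B1 B2 B3 B4 B5 B6 B7 B8 : Set
  B1 = ∀ x y z → B x y z → #[ x , y , z ]
  B2 = ∀ x y z → B x y z → B z y x
  B3 = ∀ x y z → B x y z → ¬ B x z y
  B4 = ∀ x y z u → B x y z → B y z u → B x y u
  B5 = ∀ x y z u → B x y z → B y u z → B x y u
  B6 = ∀ x y z → #[ x , y , z ] → B x y z ⊎ B x z y ⊎ B y x z
  B7 = ∀ y → ∃[ x ] ∃[ z ] B x y z
  B8 = ∀ x z → ¬ x ≡ z → ∃[ y ] B x y z

LBWE : Pred Frame Level.zero
LBWE F = B1 F × B2 F × B3 F × B4 F × B5 F × B6 F × B7 F

DLBWE : Pred Frame Level.zero
DLBWE F = LBWE F × B8 F

data Form : Set where
  ⊤'   : Form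
  var  : ℕ → Form
  nom  : ℕ → Form
  ¬'_  : Form → Form
  _∧'_ : Form → Form → Form
  ⟨B⟩  : Form → Form → Form
  at_∙_ : ℕ → Form → Form

-- valuations: variables ↦ subsets of W; nominal i ↦ the unique element of V(i)
record Valuation (F : Frame) : Set₁ where
  field
    val  : ℕ → Frame.W F → Set
    nomV : ℕ → Frame.W F

module _ {F : Frame} (V : Valuation F) where
  open Frame F
  open Valuation V
  _⊩_ : W → Form → Set
  w ⊩ ⊤'        = ⊤
  w ⊩ var n     = val n w
  w ⊩ nom i     = nomV i ≡ w
  w ⊩ (¬' φ)    = ¬ (w ⊩ φ)
  w ⊩ (φ ∧' ψ)  = (w ⊩ φ) × (w ⊩ ψ)
  w ⊩ ⟨B⟩ φ ψ   = ∃[ x ] ∃[ y ] ((x ⊩ φ) × (y ⊩ ψ) × B x w y)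
  w ⊩ (at i ∙ φ) = nomV i ⊩ φ

Valid : Frame → Form → Set₁
Valid F φ = (V : Valuation F) → (w : Frame.W F) → _⊩_ V w φ

ValidSet : Frame → Pred Form Level.zero → Set₁
ValidSet F Φ = ∀ φ → φ ∈ Φ → Valid F φ

Definable : Pred Frame Level.zero → Set₁
Definable K = Σ (Pred Form Level.zero) λ Φ → ∀ F → (K F ⇔ ValidSet F Φ)

RelDefinableB8 : Set₁
RelDefinableB8 = Σ (Pred Form Level.zero) λ Φ → ∀ F → LBWE F → (B8 F ⇔ ValidSet F Φ)

{-# OPTIONS --safe #-}
-- Each of (B1)–(B7) is defined, frame by frame, by one formula β1–β7 whose
-- nominals name the points the axiom quantifies over (excluded middle is used
-- to read the positive conclusions of (B2), (B4)–(B6) off validity).  So LBWE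
-- is definable, and for definable K the class K ∩ P is definable exactly when
-- P is definable relative to K: one direction adds the formulas for K to those
-- for P, the other keeps the formulas for K ∩ P.
module Submission where

open import Defs
open import Level using (0ℓ)
open import Axiom.ExcludedMiddle using (ExcludedMiddle)
open import Axiom.DoubleNegationElimination using (em⇒dne)
open import Data.Unit using (⊤; tt)
open import Data.Product using (Σ; ∃-syntax; _×_; _,_; proj₁; proj₂)
open import Data.Sum using (inj₁; inj₂; [_,_]′)
open import Data.List using (List; []; _∷_)
open import Data.List.Membership.Propositional using () renaming (_∈_ to _∈ₗ_)
open import Data.List.Relation.Unary.All as All using (All; []; _∷_)
open import Function using (_∘_)
open import Function.Bundles using (_⇔_; mk⇔; Equivalence)
open import Function.Construct.Composition using (_⇔-∘_)
open import Function.Construct.Symmetry using (⇔-sym)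
open import Relation.Binary.PropositionalEquality using (_≡_; refl; sym)
open import Relation.Unary using (Pred; _∩_; _∪_)

open Equivalence using (to; from)

RelativelyDefinable : Pred Frame 0ℓ → Pred Frame 0ℓ → Set₁
RelativelyDefinable K P = Σ (Pred Form 0ℓ) λ Φ → ∀ F → K F → (P F ⇔ ValidSet F Φ)

module _ {K P : Pred Frame 0ℓ} where

  ∩-definable⇒relativelyDefinable : Definable (K ∩ P) → RelativelyDefinable K P
  ∩-definable⇒relativelyDefinable (Φ , def) = Φ , λ F k →
    mk⇔ (λ p → to (def F) (k , p)) (proj₂ ∘ from (def F))

  definable∧relativelyDefinable⇒∩-definable :
    Definable K → RelativelyDefinable K P → Definable (K ∩ P)
  definable∧relativelyDefinable⇒∩-definable (Ψ , defK) (Φ , defP) =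
    Ψ ∪ Φ , λ F → mk⇔ (valid F) (member F)
    where
    valid : ∀ F → (K ∩ P) F → ValidSet F (Ψ ∪ Φ)
    valid F (k , p) φ (inj₁ φ∈Ψ) = to (defK F) k φ φ∈Ψ
    valid F (k , p) φ (inj₂ φ∈Φ) = to (defP F k) p φ φ∈Φ

    member : ∀ F → ValidSet F (Ψ ∪ Φ) → (K ∩ P) F
    member F v = k , from (defP F k) (λ φ → v φ ∘ inj₂)
      where
      k = from (defK F) (λ φ → v φ ∘ inj₁)

ValidSet-∈⇔All : ∀ {F} {xs : List Form} → ValidSet F (_∈ₗ xs) ⇔ All (Valid F) xs
ValidSet-∈⇔All = mk⇔ (λ v → All.tabulate (v _)) (λ vs φ → All.lookup vs)

infixr 5 _⇒'_
_⇒'_ : Form → Form → Form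
φ ⇒' ψ = ¬' (φ ∧' (¬' ψ))

i₀ i₁ i₂ i₃ : Form
i₀ = nom 0
i₁ = nom 1
i₂ = nom 2
i₃ = nom 3

β1 β2 β3 β4 β5 β6 β7 : Form
β1 = (¬' (i₀ ∧' ⟨B⟩ i₀ ⊤')) ∧' ((¬' ⟨B⟩ i₀ i₀) ∧' (¬' (i₀ ∧' ⟨B⟩ ⊤' i₀)))
β2 = ⟨B⟩ i₀ i₁ ⇒' ⟨B⟩ i₁ i₀
β3 = ¬' ((i₂ ∧' ⟨B⟩ i₀ i₁) ∧' (at 1 ∙ ⟨B⟩ i₀ i₂))
β4 = (i₀ ∧' ⟨B⟩ i₁ (⟨B⟩ i₀ i₃)) ⇒' ⟨B⟩ i₁ i₃
β5 = (i₀ ∧' (⟨B⟩ i₁ i₂ ∧' (at 3 ∙ ⟨B⟩ i₀ i₂))) ⇒' ⟨B⟩ i₁ i₃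
β6 = ¬' (distinct ∧' ((¬' (at 1 ∙ ⟨B⟩ i₀ i₂))
                    ∧' ((¬' (at 2 ∙ ⟨B⟩ i₀ i₁)) ∧' (¬' (at 0 ∙ ⟨B⟩ i₁ i₂)))))
  where
  distinct : Form
  distinct = (¬' (at 0 ∙ i₁)) ∧' ((¬' (at 0 ∙ i₂)) ∧' (¬' (at 1 ∙ i₂)))
β7 = ⟨B⟩ ⊤' ⊤'

lbweAxioms : List Form
lbweAxioms = β1 ∷ β2 ∷ β3 ∷ β4 ∷ β5 ∷ β6 ∷ β7 ∷ []

module _ {F : Frame} where
  open Frame F

  nominals : W → W → W → W → Valuation F
  nominals x y z u = record
    { val  = λ _ _ → ⊤
    ; nomV = λ { 0 → x ; 1 → y ; 2 → z ; _ → u }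
    }

  -- The right-hand side is w ⊩ ⟨B⟩ i j unfolded for points x, z named by i, j;
  -- stating it via _⊩_ would leave the valuation and nominals uninferable.
  module _ {x w z : W} where

    ⟨B⟩-nom⁺ : B x w z → ∃[ x′ ] ∃[ z′ ] (x ≡ x′ × z ≡ z′ × B x′ w z′)
    ⟨B⟩-nom⁺ b = _ , _ , refl , refl , b

    ⟨B⟩-nom⁻ : ∃[ x′ ] ∃[ z′ ] (x ≡ x′ × z ≡ z′ × B x′ w z′) → B x w z
    ⟨B⟩-nom⁻ (_ , _ , refl , refl , b) = b

  B1⇔Valid-β1 : B1 F ⇔ Valid F β1
  B1⇔Valid-β1 = mk⇔ valid distinct
    where
    valid : B1 F → Valid F β1
    valid b1 V w =
        (λ { (refl , _ , _ , refl , _ , b) → proj₁ (b1 _ _ _ b) refl })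
      , (λ { (_ , _ , refl , refl , b) → proj₁ (proj₂ (b1 _ _ _ b)) refl })
      , (λ { (refl , _ , _ , _ , refl , b) → proj₂ (proj₂ (b1 _ _ _ b)) refl })

    distinct : Valid F β1 → B1 F
    distinct v x y z b =
        (λ x≡y → proj₁ (v (nominals x x x x) y) (x≡y , x , z , refl , tt , b))
      , (λ x≡z → proj₁ (proj₂ (v (nominals x x x x) y)) (x , z , refl , x≡z , b))
      , (λ y≡z → proj₂ (proj₂ (v (nominals z z z z) y)) (sym y≡z , x , z , tt , refl , b))

  B2⇔Valid-β2 : ExcludedMiddle 0ℓ → B2 F ⇔ Valid F β2
  B2⇔Valid-β2 em = mk⇔ valid symmetric
    where
    valid : B2 F → Valid F β2
    valid b2 V w (b , ¬b') = ¬b' (⟨B⟩-nom⁺ (b2 _ _ _ (⟨B⟩-nom⁻ b)))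

    symmetric : Valid F β2 → B2 F
    symmetric v x y z b =
      ⟨B⟩-nom⁻ (em⇒dne em λ ¬b' → v (nominals x z x x) y (⟨B⟩-nom⁺ b , ¬b'))

  B3⇔Valid-β3 : B3 F ⇔ Valid F β3
  B3⇔Valid-β3 = mk⇔ valid asymmetric
    where
    valid : B3 F → Valid F β3
    valid b3 V w ((refl , b) , b') = b3 _ _ _ (⟨B⟩-nom⁻ b) (⟨B⟩-nom⁻ b')

    asymmetric : Valid F β3 → B3 F
    asymmetric v x y z b b' = v (nominals x z y y) y ((refl , ⟨B⟩-nom⁺ b) , ⟨B⟩-nom⁺ b')

  B4⇔Valid-β4 : ExcludedMiddle 0ℓ → B4 F ⇔ Valid F β4
  B4⇔Valid-β4 em = mk⇔ valid transitive
    where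
    valid : B4 F → Valid F β4
    valid b4 V w ((refl , _ , _ , refl , b' , b) , ¬c) =
      ¬c (⟨B⟩-nom⁺ (b4 _ _ _ _ b (⟨B⟩-nom⁻ b')))

    transitive : Valid F β4 → B4 F
    transitive v x y z u b b' = ⟨B⟩-nom⁻ (em⇒dne em λ ¬c →
      v (nominals y x x u) y ((refl , x , z , refl , ⟨B⟩-nom⁺ b' , b) , ¬c))

  B5⇔Valid-β5 : ExcludedMiddle 0ℓ → B5 F ⇔ Valid F β5
  B5⇔Valid-β5 em = mk⇔ valid transitive
    where
    valid : B5 F → Valid F β5
    valid b5 V w ((refl , b , b') , ¬c) =
      ¬c (⟨B⟩-nom⁺ (b5 _ _ _ _ (⟨B⟩-nom⁻ b) (⟨B⟩-nom⁻ b')))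

    transitive : Valid F β5 → B5 F
    transitive v x y z u b b' = ⟨B⟩-nom⁻ (em⇒dne em λ ¬c →
      v (nominals y x z u) y ((refl , ⟨B⟩-nom⁺ b , ⟨B⟩-nom⁺ b') , ¬c))

  B6⇔Valid-β6 : ExcludedMiddle 0ℓ → B6 F ⇔ Valid F β6
  B6⇔Valid-β6 em = mk⇔ valid connected
    where
    valid : B6 F → Valid F β6
    valid b6 V w ((y≢x , z≢x , z≢y) , ¬xyz , ¬xzy , ¬yxz) =
      [ ¬xyz ∘ ⟨B⟩-nom⁺ , [ ¬xzy ∘ ⟨B⟩-nom⁺ , ¬yxz ∘ ⟨B⟩-nom⁺ ]′ ]′
        (b6 _ _ _ (y≢x ∘ sym , z≢x ∘ sym , z≢y ∘ sym))

    connected : Valid F β6 → B6 F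
    connected v x y z (x≢y , x≢z , y≢z) = em⇒dne em λ none →
      v (nominals x y z z) x
        ( (x≢y ∘ sym , x≢z ∘ sym , y≢z ∘ sym)
        , none ∘ inj₁ ∘ ⟨B⟩-nom⁻
        , none ∘ inj₂ ∘ inj₁ ∘ ⟨B⟩-nom⁻
        , none ∘ inj₂ ∘ inj₂ ∘ ⟨B⟩-nom⁻ )

  B7⇔Valid-β7 : B7 F ⇔ Valid F β7
  B7⇔Valid-β7 = mk⇔ valid unbounded
    where
    valid : B7 F → Valid F β7
    valid b7 V w = let (x , z , b) = b7 w in x , z , tt , tt , b

    unbounded : Valid F β7 → B7 F
    unbounded v y = let (x , z , _ , _ , b) = v (nominals y y y y) y in x , z , b

  LBWE⇔Valid-lbweAxioms : ExcludedMiddle 0ℓ → LBWE F ⇔ All (Valid F) lbweAxioms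
  LBWE⇔Valid-lbweAxioms em = mk⇔
    (λ (b1 , b2 , b3 , b4 , b5 , b6 , b7) →
        to B1⇔Valid-β1 b1 ∷ to (B2⇔Valid-β2 em) b2 ∷ to B3⇔Valid-β3 b3
      ∷ to (B4⇔Valid-β4 em) b4 ∷ to (B5⇔Valid-β5 em) b5 ∷ to (B6⇔Valid-β6 em) b6
      ∷ to B7⇔Valid-β7 b7 ∷ [])
    (λ { (v1 ∷ v2 ∷ v3 ∷ v4 ∷ v5 ∷ v6 ∷ v7 ∷ []) →
          from B1⇔Valid-β1 v1 , from (B2⇔Valid-β2 em) v2 , from B3⇔Valid-β3 v3
        , from (B4⇔Valid-β4 em) v4 , from (B5⇔Valid-β5 em) v5 , from (B6⇔Valid-β6 em) v6
        , from B7⇔Valid-β7 v7 })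

LBWE-definable : ExcludedMiddle 0ℓ → Definable LBWE
LBWE-definable em = (_∈ₗ lbweAxioms) , λ F → ⇔-sym ValidSet-∈⇔All ⇔-∘ LBWE⇔Valid-lbweAxioms em

theorem5p1 : ExcludedMiddle 0ℓ → (Definable DLBWE ⇔ RelDefinableB8)
theorem5p1 em = mk⇔ ∩-definable⇒relativelyDefinable
                    (definable∧relativelyDefinable⇒∩-definable (LBWE-definable em))
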